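{- Let ${\sf V}$ be a quantale, $X$ a set, and $c:{\sf P}X\to{\sf V}^X$ monotone. Define $\overline{c}:{\sf P}X\to{\sf V}^X$ by $(\overline{c}A)(x)=\bigvee_{v\in{\sf V}} v\otimes c(c^vA)(x)$, where $c^vA=\{z\in X\mid v\le (cA)(z)\}$. Then: (1) if $c$ satisfies (R) ${\sf k}\le (cA)(x)$ whenever $x\in A\subseteq X$, then $c\le\overline{c}$; (2) $c$ satisfies (T) $\big(\bigwedge_{y\in B}(cA)(y)\big)\otimes (cB)(x)\le (cA)(x)$ for all $A,B\subseteq X$, $x\in X$, if and only if $\overline{c}\le c$; (3) for any map $d:{\sf P}X\to{\sf V}^X$ with $d\le c$, one has $\overline{d}\le\overline{c}$ (with $\overline{d}$ defined analogously from $d$).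
   Context: A quantale ${\sf V}=({\sf V},\otimes,{\sf k})$ is a complete lattice with a (not necessarily commutative) monoid structure $(\otimes,{\sf k})$ such that $\otimes$ preserves arbitrary suprema in each variable. ${\sf P}X$ is the power set of $X$; ${\sf V}^X$ is the set of maps $X\to{\sf V}$, ordered pointwise, and maps ${\sf P}X\to{\sf V}^X$ are compared pointwise. $c$ is monotone if $A\subseteq B\subseteq X$ implies $cA\le cB$. -}

module Defs where

open import Level using (Level; suc)
open import Data.Product using (Σ; _×_; proj₁)
open import Relation.Binary.PropositionalEquality using (_≡_)
open import Relation.Unary using (Pred; _∈_; _⊆_)

record Quantale (ℓ : Level) : Set (suc ℓ) where
  infix 4 _≤_
  infixl 7 _⊗_
  field
    Carrier : Set ℓ
    _≤_     : Carrier → Carrier → Set ℓ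
    ≤-refl  : ∀ {a} → a ≤ a
    ≤-trans : ∀ {a b c} → a ≤ b → b ≤ c → a ≤ c
    ≤-antisym : ∀ {a b} → a ≤ b → b ≤ a → a ≡ b
    ⋁       : {I : Set ℓ} → (I → Carrier) → Carrier
    ⋁-ub    : {I : Set ℓ} (f : I → Carrier) (i : I) → f i ≤ ⋁ f
    ⋁-least : {I : Set ℓ} (f : I → Carrier) (a : Carrier) → (∀ i → f i ≤ a) → ⋁ f ≤ a
    ⋀       : {I : Set ℓ} → (I → Carrier) → Carrier
    ⋀-lb    : {I : Set ℓ} (f : I → Carrier) (i : I) → ⋀ f ≤ f i
    ⋀-greatest : {I : Set ℓ} (f : I → Carrier) (a : Carrier) → (∀ i → a ≤ f i) → a ≤ ⋀ f
    _⊗_     : Carrier → Carrier → Carrier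
    k       : Carrier
    ⊗-assoc : ∀ a b c → (a ⊗ b) ⊗ c ≡ a ⊗ (b ⊗ c)
    ⊗-identityˡ : ∀ a → k ⊗ a ≡ a
    ⊗-identityʳ : ∀ a → a ⊗ k ≡ a
    ⊗-⋁ˡ : {I : Set ℓ} (f : I → Carrier) (a : Carrier) → (⋁ f) ⊗ a ≡ ⋁ (λ i → f i ⊗ a)
    ⊗-⋁ʳ : {I : Set ℓ} (a : Carrier) (f : I → Carrier) → a ⊗ (⋁ f) ≡ ⋁ (λ i → a ⊗ f i)

module _ {ℓ : Level} (V : Quantale ℓ) (X : Set ℓ) where
  open Quantale V

  ClosureMap : Set (suc ℓ)
  ClosureMap = Pred X ℓ → X → Carrier

  _≤ᶜ_ : ClosureMap → ClosureMap → Set (suc ℓ)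
  c ≤ᶜ d = ∀ (A : Pred X ℓ) (x : X) → c A x ≤ d A x

  Monotone : ClosureMap → Set (suc ℓ)
  Monotone c = ∀ {A B : Pred X ℓ} → A ⊆ B → ∀ x → c A x ≤ c B x

  level-set : ClosureMap → Carrier → Pred X ℓ → Pred X ℓ
  level-set c v A z = v ≤ c A z

  closure-bar : ClosureMap → ClosureMap
  closure-bar c A x = ⋁ {I = Carrier} (λ v → v ⊗ c (level-set c v A) x)

  Refl-R : ClosureMap → Set (suc ℓ)
  Refl-R c = ∀ (A : Pred X ℓ) (x : X) → x ∈ A → k ≤ c A x

  Trans-T : ClosureMap → Set (suc ℓ)
  Trans-T c = ∀ (A B : Pred X ℓ) (x : X) →
    ⋀ {I = Σ X (λ y → y ∈ B)} (λ p → c A (proj₁ p)) ⊗ c B x ≤ c A x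

-- Each claim reduces to a single term v ⊗ c(c^v A)(x) of the join defining c̄,
-- using monotonicity of ⊗ (a consequence of join preservation) and three facts
-- about level sets: (R) puts A inside c^k A; every B lies inside c^v A for
-- v = ⋀_{y ∈ B} (cA)(y), which is how (T) and c̄ ≤ c match up; and d ≤ c makes
-- each level set of d a subset of the corresponding level set of c.
module Submission where

open import Defs
open import Level using (Level; Lift; lift)
open import Data.Bool using (Bool; true; false)
open import Data.Product using (_×_; _,_; proj₁; proj₂; Σ)
open import Function.Bundles using (_⇔_; mk⇔)
open import Relation.Binary.PropositionalEquality using (_≡_; subst; sym)
open import Relation.Unary using (Pred; _⊆_)

module QuantaleProperties {ℓ : Level} (V : Quantale ℓ) where
  open Quantale V

  pair : Carrier → Carrier → Lift ℓ Bool → Carrier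
  pair a b (lift true)  = a
  pair a b (lift false) = b

  ⋁-pair-≤ : ∀ {a b} → a ≤ b → ⋁ (pair a b) ≡ b
  ⋁-pair-≤ {a} {b} a≤b = ≤-antisym
    (⋁-least (pair a b) b λ { (lift true) → a≤b ; (lift false) → ≤-refl })
    (⋁-ub (pair a b) (lift false))

  -- Both follow by writing b as the join of the pair {a, b}.
  ⊗-monoˡ-≤ : ∀ {a b} x → a ≤ b → a ⊗ x ≤ b ⊗ x
  ⊗-monoˡ-≤ {a} {b} x a≤b =
    subst (λ t → a ⊗ x ≤ t ⊗ x) (⋁-pair-≤ a≤b)
      (subst (a ⊗ x ≤_) (sym (⊗-⋁ˡ (pair a b) x))
        (⋁-ub (λ i → pair a b i ⊗ x) (lift true)))

  ⊗-monoʳ-≤ : ∀ {a b} x → a ≤ b → x ⊗ a ≤ x ⊗ b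
  ⊗-monoʳ-≤ {a} {b} x a≤b =
    subst (λ t → x ⊗ a ≤ x ⊗ t) (⋁-pair-≤ a≤b)
      (subst (x ⊗ a ≤_) (sym (⊗-⋁ʳ x (pair a b)))
        (⋁-ub (λ i → x ⊗ pair a b i) (lift true)))

module ClosureBarProperties {ℓ : Level} (V : Quantale ℓ) (X : Set ℓ) where
  open Quantale V
  open QuantaleProperties V

  level-set-mono : ∀ {c d} → _≤ᶜ_ V X d c → ∀ v A →
    level-set V X d v A ⊆ level-set V X c v A
  level-set-mono d≤c v A {z} v≤dAz = ≤-trans v≤dAz (d≤c A z)

  ⊆-level-set-k : ∀ {c} → Refl-R V X c → ∀ A → A ⊆ level-set V X c k A
  ⊆-level-set-k R A {z} z∈A = R A z z∈A

  ⊆-level-set-⋀ : ∀ c (A B : Pred X ℓ) →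
    B ⊆ level-set V X c (⋀ {I = Σ X B} (λ p → c A (proj₁ p))) A
  ⊆-level-set-⋀ c A B {y} y∈B = ⋀-lb (λ p → c A (proj₁ p)) (y , y∈B)

  term-≤-closure-bar : ∀ c v A x →
    v ⊗ c (level-set V X c v A) x ≤ closure-bar V X c A x
  term-≤-closure-bar c v A x = ⋁-ub (λ w → w ⊗ c (level-set V X c w A) x) v

  closure-bar-least : ∀ c A x {a} →
    (∀ v → v ⊗ c (level-set V X c v A) x ≤ a) → closure-bar V X c A x ≤ a
  closure-bar-least c A x {a} = ⋁-least (λ v → v ⊗ c (level-set V X c v A) x) a

  ≤ᶜ-closure-bar : ∀ {c} → Monotone V X c → Refl-R V X c →
    _≤ᶜ_ V X c (closure-bar V X c)
  ≤ᶜ-closure-bar {c} mono R A x = ≤-trans (mono (⊆-level-set-k R A) x)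
    (subst (_≤ closure-bar V X c A x) (⊗-identityˡ _) (term-≤-closure-bar c k A x))

  Trans-T⇒closure-bar-≤ᶜ : ∀ {c} → Trans-T V X c → _≤ᶜ_ V X (closure-bar V X c) c
  Trans-T⇒closure-bar-≤ᶜ {c} T A x = closure-bar-least c A x λ v →
    ≤-trans (⊗-monoˡ-≤ _ (⋀-greatest (λ p → c A (proj₁ p)) v (λ p → proj₂ p)))
            (T A (level-set V X c v A) x)

  closure-bar-≤ᶜ⇒Trans-T : ∀ {c} → Monotone V X c →
    _≤ᶜ_ V X (closure-bar V X c) c → Trans-T V X c
  closure-bar-≤ᶜ⇒Trans-T {c} mono c̄≤c A B x =
    ≤-trans (⊗-monoʳ-≤ v (mono (⊆-level-set-⋀ c A B) x))
            (≤-trans (term-≤-closure-bar c v A x) (c̄≤c A x))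
    where v = ⋀ {I = Σ X B} (λ p → c A (proj₁ p))

  closure-bar-mono : ∀ {c d} → Monotone V X c → _≤ᶜ_ V X d c →
    _≤ᶜ_ V X (closure-bar V X d) (closure-bar V X c)
  closure-bar-mono {c} {d} mono d≤c A x = closure-bar-least d A x λ v →
    ≤-trans (⊗-monoʳ-≤ v (≤-trans (d≤c _ x) (mono (level-set-mono d≤c v A) x)))
            (term-≤-closure-bar c v A x)

lemma2p4 : {ℓ : Level} (V : Quantale ℓ) (X : Set ℓ) (c : ClosureMap V X) →
    Monotone V X c →
    (Refl-R V X c → _≤ᶜ_ V X c (closure-bar V X c))
    × (Trans-T V X c ⇔ _≤ᶜ_ V X (closure-bar V X c) c)
    × ((d : ClosureMap V X) → _≤ᶜ_ V X d c →
    _≤ᶜ_ V X (closure-bar V X d) (closure-bar V X c))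
lemma2p4 V X c mono =
    ≤ᶜ-closure-bar mono
  , mk⇔ Trans-T⇒closure-bar-≤ᶜ (closure-bar-≤ᶜ⇒Trans-T mono)
  , λ d → closure-bar-mono mono
  where open ClosureBarProperties V X
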